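{- Let $G$ be a finite abelian group of even order $n$. Then $f^\star_{\max}(G)\geq 2^{(n-2)/4}$.
   Context: For a finite abelian group $(G,+)$: a triple $x,y,z\in G$ with $x+y=z$ and $x,y,z$ pairwise distinct is a distinct Schur triple. A subset $S\subseteq G$ is distinct sum-free if it contains no distinct Schur triple, and a distinct sum-free set is maximal if it is not properly contained in another distinct sum-free subset of $G$. $f^\star_{\max}(G)$ denotes the number of maximal distinct sum-free subsets of $G$. -}

module Defs where

open import Data.Nat using (ℕ; zero; suc; _+_)
open import Data.Fin using (Fin)
open import Data.Fin.Properties using (all?; _≟_)
open import Data.Fin.Subset using (Subset; _∈_; _⊆_; inside; outside)
open import Data.Fin.Subset.Properties using (_∈?_; _⊆?_; anySubset?)
open import Data.Bool using (true; false)
open import Data.List using (List; []; _∷_; _++_; map)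
open import Data.Vec using ([]; _∷_)
open import Data.Product using (_×_; _,_; ∃)
open import Relation.Nullary using (¬_; Dec; yes; no; does)
open import Relation.Nullary.Decidable using (¬?; _×-dec_; _→-dec_)
open import Relation.Binary.PropositionalEquality using (_≡_; _≢_)
open import Data.Vec.Properties using (≡-dec)
open import Data.Bool.Properties using () renaming (_≟_ to _≟B_)

-- A group of order n is represented with carrier Fin n (every finite group of
-- order n is isomorphic to one on Fin n); the binary operation is _∙_.

DistinctSumFree : ∀ {n} → (Fin n → Fin n → Fin n) → Subset n → Set
DistinctSumFree {n} _∙_ S =
  (x y z : Fin n) → x ∈ S → y ∈ S → z ∈ S →
  x ≢ y → y ≢ z → x ≢ z → ¬ (x ∙ y ≡ z)

MaximalDistinctSumFree : ∀ {n} → (Fin n → Fin n → Fin n) → Subset n → Set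
MaximalDistinctSumFree {n} _∙_ S =
  DistinctSumFree _∙_ S × ((T : Subset n) → S ⊆ T → DistinctSumFree _∙_ T → T ≡ S)

distinctSumFree? : ∀ {n} (_∙_ : Fin n → Fin n → Fin n) (S : Subset n) →
                   Dec (DistinctSumFree _∙_ S)
distinctSumFree? _∙_ S =
  all? λ x → all? λ y → all? λ z →
    (x ∈? S) →-dec (y ∈? S) →-dec (z ∈? S) →-dec
    ¬? (x ≟ y) →-dec ¬? (y ≟ z) →-dec ¬? (x ≟ z) →-dec ¬? ((x ∙ y) ≟ z)

private
  allSubsets? : ∀ {n} {P : Subset n → Set} → ((T : Subset n) → Dec (P T)) →
                Dec ((T : Subset n) → P T)
  allSubsets? {P = P} P? with anySubset? (λ T → ¬? (P? T))
  ... | yes (T , ¬PT) = no λ all → ¬PT (all T)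
  ... | no ¬ex = yes λ T → helper T (P? T)
    where
      helper : (T : Subset _) → Dec (P T) → P T
      helper T (yes p) = p
      helper T (no ¬p) with ¬ex (T , ¬p)
      ... | ()

maximalDistinctSumFree? : ∀ {n} (_∙_ : Fin n → Fin n → Fin n) (S : Subset n) →
                          Dec (MaximalDistinctSumFree _∙_ S)
maximalDistinctSumFree? _∙_ S =
  distinctSumFree? _∙_ S ×-dec
  allSubsets? (λ T → (S ⊆? T) →-dec distinctSumFree? _∙_ T →-dec ≡-dec _≟B_ T S)

allSubsets : (n : ℕ) → List (Subset n)
allSubsets zero = [] ∷ []
allSubsets (suc n) = map (inside ∷_) (allSubsets n) ++ map (outside ∷_) (allSubsets n)

countSubsets : ∀ {n} {P : Subset n → Set} → ((S : Subset n) → Dec (P S)) → ℕ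
countSubsets {n} P? = go (allSubsets n)
  where
    go : List (Subset n) → ℕ
    go [] = 0
    go (S ∷ Ss) with does (P? S)
    ... | true  = suc (go Ss)
    ... | false = go Ss

fStarMax : ∀ {n} → (Fin n → Fin n → Fin n) → ℕ
fStarMax _∙_ = countSubsets (maximalDistinctSumFree? _∙_)

{-# OPTIONS --safe #-}

-- In an abelian group G of even order the elements x ≠ x⁻¹ pair off, so there is an
-- involution; hence squaring is not onto, the squares form a proper subgroup, and enlarging
-- it by one coset at a time yields a subgroup H of index 2.  Fix c ∈ H with c ∙ c = ε, and
-- c ≠ ε if H has such an element.  The maps x ↦ x⁻¹ and x ↦ x ∙ c generate a Klein
-- four-group acting on G ∖ H with orbits of 2 or 4 points, apart from at most one fixed
-- point when c = ε.  For every transversal T of these orbits, {ε , c} ∪ T is distinct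
-- sum-free, as products of two elements outside H lie in H; and two different transversals
-- contain distinct a, b from one orbit, which form a distinct Schur triple with ε or c.  So
-- these sets have pairwise different maximal extensions, and there are ∏ kᵢ ≥ 2^(∑ kᵢ / 2)
-- of them, where ∑ kᵢ ≥ n / 2 − 1.

module Submission where

open import Algebra.Bundles using (AbelianGroup)
import Algebra.Properties.AbelianGroup as AbelianGroupProperties
import Algebra.Properties.CommutativeSemigroup as CommutativeSemigroupProperties
open import Algebra.Structures using (IsAbelianGroup; IsGroup)
open import Data.Bool using (Bool; true; false; _xor_)
open import Data.Bool.Properties using (xor-same) renaming (_≟_ to _≟ᵇ_)
open import Data.Empty using (⊥)
open import Data.Fin using (Fin) renaming (_<_ to _<ᶠ_)
import Data.Fin.Properties as Fin
open import Data.Fin.Subset using (Subset; inside; outside; ⁅_⁆; _∪_; ∣_∣)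
  renaming (_∈_ to _∈ₛ_; _∉_ to _∉ₛ_; _⊆_ to _⊆ₛ_)
open import Data.Fin.Subset.Properties
  using (_∈?_; ∈⊤; ∣⊤∣≡n; p⊂q⇒∣p∣<∣q∣; p⊆p∪q; q⊆p∪q; x∈p∪q⁻; x∈⁅x⁆; x∈⁅y⁆⇒x≡y; ⊆-antisym)
open import Data.List using (List; []; _∷_; length; filter; map; _++_; cartesianProductWith; allFin)
open import Data.List.Properties
  using (length-tabulate; length-filter; length-++; length-map; filter-notAll; filter-accept; filter-reject)
import Data.List.Membership.DecPropositional as DecMembership
open import Data.List.Membership.Propositional using (_∈_)
open import Data.List.Membership.Propositional.Properties
  using (∈-allFin; ∈-filter⁺; ∈-filter⁻; ∈-map⁺; ∈-map⁻; ∈-++⁺ˡ; ∈-++⁺ʳ; ∈-cartesianProductWith⁻)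
open import Data.List.Relation.Binary.Subset.Propositional using (_⊆_)
open import Data.List.Relation.Unary.All as All using (All; []; _∷_)
import Data.List.Relation.Unary.All.Properties as All
open import Data.List.Relation.Unary.AllPairs as AllPairs using (AllPairs; []; _∷_)
import Data.List.Relation.Unary.AllPairs.Properties as AllPairs
open import Data.List.Relation.Unary.Any as Any using (here; there)
open import Data.List.Relation.Unary.Unique.Propositional using (Unique)
import Data.List.Relation.Unary.Unique.Propositional.Properties as Unique
open import Data.Nat using (ℕ; zero; suc; _+_; _*_; _^_; _∸_; _≤_; _<_; z≤n; s≤s)
open import Data.Nat.Divisibility using (_∣_; divides; ∣m+n∣m⇒∣n; ∣1⇒≡1)
open import Data.Nat.Properties
  using (module ≤-Reasoning; ≤-refl; ≤-trans; ≤-reflexive; ≤-antisym; <-irrefl; <⇒≱; n≤1+n; m≤m+n;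
         +-comm; +-suc; +-identityʳ; *-comm; *-assoc; *-identityʳ; [m*n]*[o*p]≡[m*o]*[n*p];
         +-mono-≤; +-monoˡ-≤; +-monoʳ-≤; *-mono-≤; ∸-monoˡ-≤; ^-monoʳ-≤; ^-monoˡ-≤; ^-distribˡ-+-*)
open import Data.Product using (_×_; _,_; proj₁; proj₂; ∃; ∃₂; Σ-syntax)
open import Data.Sum using (_⊎_; inj₁; inj₂; [_,_]′)
import Data.Vec as Vec
open import Data.Vec.Properties using (lookup∘tabulate; []=⇒lookup; lookup⇒[]=; ≡-dec)
open import Function using (_on_; _∘_)
open import Level using (Level; _⊔_; 0ℓ)
open import Relation.Binary using (Rel; DecidableEquality; IsEquivalence; tri<; tri≈; tri>)
  renaming (Decidable to Decidable₂)
open import Relation.Binary.PropositionalEquality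
  using (_≡_; _≢_; refl; sym; trans; cong; cong₂; subst; module ≡-Reasoning)
open import Relation.Nullary using (Dec; ¬_; yes; no; ¬?; contradiction; does)
open import Relation.Nullary.Decidable using (dec-true; dec-false; decidable-stable; _×-dec_; _⊎-dec_)
import Relation.Nullary.Decidable as Dec
open import Relation.Unary using (Pred; Decidable)
open import Relation.Unary.Properties using (∁?)

open import Defs

private variable
  a b d p q r : Level
  A : Set a
  B : Set b
  D : Set d

module _ {P : Pred A p} (P? : Decidable P) where

  length-filter+filter-∁ : ∀ xs → length (filter P? xs) + length (filter (∁? P?) xs) ≡ length xs
  length-filter+filter-∁ [] = refl
  length-filter+filter-∁ (x ∷ xs) with P? x
  ... | yes _ = cong suc (length-filter+filter-∁ xs)
  ... | no _  = trans (+-suc _ _) (cong suc (length-filter+filter-∁ xs))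

  filter-absorbs : {Q : Pred A q} (Q? : Decidable Q) → (∀ {x} → P x → Q x) →
                   ∀ xs → filter P? (filter Q? xs) ≡ filter P? xs
  filter-absorbs Q? P⇒Q [] = refl
  filter-absorbs Q? P⇒Q (x ∷ xs) with P? x
  ... | yes px = begin
    filter P? (filter Q? (x ∷ xs))  ≡⟨ cong (filter P?) (filter-accept Q? (P⇒Q px)) ⟩
    filter P? (x ∷ filter Q? xs)    ≡⟨ filter-accept P? px ⟩
    x ∷ filter P? (filter Q? xs)    ≡⟨ cong (x ∷_) (filter-absorbs Q? P⇒Q xs) ⟩
    x ∷ filter P? xs                ∎
    where open ≡-Reasoning
  ... | no ¬px with Q? x
  ...   | yes _ = trans (filter-reject P? ¬px) (filter-absorbs Q? P⇒Q xs)
  ...   | no _  = filter-absorbs Q? P⇒Q xs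

module _ (_≟_ : DecidableEquality A) where

  Unique⇒length-mono-⊆ : {xs ys : List A} → Unique xs → xs ⊆ ys → length xs ≤ length ys
  Unique⇒length-mono-⊆ {xs = []} _ _ = z≤n
  Unique⇒length-mono-⊆ {xs = x ∷ xs} {ys} (x∉xs ∷ xs!) x∷xs⊆ys = begin-strict
    length xs                ≤⟨ Unique⇒length-mono-⊆ xs! xs⊆ys-x ⟩
    length (filter ≢x? ys)   <⟨ filter-notAll ≢x? ys (Any.map (λ x≡y y≢x → y≢x (sym x≡y)) x∈ys) ⟩
    length ys                ∎
    where
    open ≤-Reasoning
    ≢x? : Decidable (_≢ x)
    ≢x? y = ¬? (y ≟ x)
    x∈ys = x∷xs⊆ys (here refl)
    xs⊆ys-x : xs ⊆ filter ≢x? ys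
    xs⊆ys-x y∈xs = ∈-filter⁺ ≢x? (x∷xs⊆ys (there y∈xs)) (λ y≡x → All.lookup x∉xs y∈xs (sym y≡x))

AllPairs-zipWith-All : {P : Pred A p} {R : Rel A q} {Q : Rel A r} {xs : List A} →
                       (∀ {x y} → P x → P y → R x y → Q x y) → All P xs → AllPairs R xs → AllPairs Q xs
AllPairs-zipWith-All f []         []         = []
AllPairs-zipWith-All f (px ∷ pxs) (rx ∷ rxs) =
  All.zipWith (λ (py , r) → f px py r) (pxs , rx) ∷ AllPairs-zipWith-All f pxs rxs

Unique∧equal⇒length≤1 : {xs : List A} → Unique xs → (∀ {x y} → x ∈ xs → y ∈ xs → x ≡ y) → length xs ≤ 1
Unique∧equal⇒length≤1 {xs = []}        _               _    = z≤n
Unique∧equal⇒length≤1 {xs = _ ∷ []}    _               _    = ≤-refl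
Unique∧equal⇒length≤1 {xs = _ ∷ _ ∷ _} ((x≢y ∷ _) ∷ _) all≡ = contradiction (all≡ (here refl) (there (here refl))) x≢y

module _ (f : A → B → D) where

  length-cartesianProductWith : ∀ xs ys →
    length (cartesianProductWith f xs ys) ≡ length xs * length ys
  length-cartesianProductWith []       ys = refl
  length-cartesianProductWith (x ∷ xs) ys = begin
    length (map (f x) ys ++ cartesianProductWith f xs ys)
      ≡⟨ length-++ (map (f x) ys) ⟩
    length (map (f x) ys) + length (cartesianProductWith f xs ys)
      ≡⟨ cong₂ _+_ (length-map (f x) ys) (length-cartesianProductWith xs ys) ⟩
    length ys + length xs * length ys
      ∎
    where open ≡-Reasoning

  AllPairs-cartesianProductWith⁺ : {R : Rel D r} {xs : List A} {ys : List B} → Unique xs →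
    (∀ {x x′} → x ∈ xs → x′ ∈ xs → x ≢ x′ → ∀ y y′ → R (f x y) (f x′ y′)) →
    (∀ {x} → x ∈ xs → AllPairs (R on f x) ys) →
    AllPairs R (cartesianProductWith f xs ys)
  AllPairs-cartesianProductWith⁺ {xs = []} _ _ _ = []
  AllPairs-cartesianProductWith⁺ {R = R} {xs = x ∷ xs} {ys} (x∉xs ∷ xs!) across within =
    AllPairs.++⁺ (AllPairs.map⁺ (within (here refl)))
                 (AllPairs-cartesianProductWith⁺ xs! (λ p p′ → across (there p) (there p′)) (within ∘ there))
                 (All.tabulate λ v∈ → All.tabulate λ w∈ → cross v∈ w∈)
    where
    cross : ∀ {v w} → v ∈ map (f x) ys → w ∈ cartesianProductWith f xs ys → R v w
    cross v∈ w∈ with ∈-map⁻ (f x) v∈ | ∈-cartesianProductWith⁻ f xs ys w∈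
    ... | y , _ , refl | x′ , y′ , x′∈ , _ , refl =
      across (here refl) (there x′∈) (All.lookup x∉xs x′∈) y y′

2^≤square : ∀ k → 2 ≤ k → k ≤ 4 → 2 ^ k ≤ k * k
2^≤square 1 (s≤s ()) _
2^≤square 2 _ _ = ≤-refl
2^≤square 3 _ _ = n≤1+n 8
2^≤square 4 _ _ = ≤-refl
2^≤square (suc (suc (suc (suc (suc _))))) _ (s≤s (s≤s (s≤s (s≤s ()))))

module PartialTransversals {A : Set a} {R : Rel A r} (R? : Decidable₂ R) (isEquivalence : IsEquivalence R) where

  open IsEquivalence isEquivalence renaming (refl to R-refl; sym to R-sym; trans to R-trans)

  class : A → List A → List A
  class x = filter (R? x)

  Independent : List A → Set _
  Independent T = ∀ {x y} → x ∈ T → y ∈ T → R x y → x ≡ y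

  Crossing : List A → List A → Set _
  Crossing T T′ = ∃₂ λ x y → x ∈ T × y ∈ T′ × R x y × x ≢ y

  ClassSizesBetween2And4 : List A → Set _
  ClassSizesBetween2And4 V = ∀ {x} → x ∈ V → 2 ≤ length (class x V) × length (class x V) ≤ 4

  record CrossingFamily (V : List A) : Set (a ⊔ r) where
    field
      members     : List (List A)
      ⊆V          : All (_⊆ V) members
      independent : All Independent members
      crossing    : AllPairs Crossing members
      many        : 2 ^ length V ≤ length members * length members

  unrelated : A → List A → List A
  unrelated x = filter (∁? (R? x))

  ∈-unrelated⁻ : ∀ x V {y} → y ∈ unrelated x V → y ∈ V × ¬ R x y
  ∈-unrelated⁻ x V = ∈-filter⁻ (∁? (R? x)) {xs = V}

  class-unrelated : ∀ x V {y} → y ∈ unrelated x V → class y (unrelated x V) ≡ class y (x ∷ V)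
  class-unrelated x V {y} y∈ = begin
    filter (R? y) (unrelated x V)  ≡⟨ filter-absorbs (R? y) (∁? (R? x)) Ryz⇒¬Rxz V ⟩
    filter (R? y) V                ≡⟨ filter-reject (R? y) (λ Ryx → ¬Rxy (R-sym Ryx)) ⟨
    filter (R? y) (x ∷ V)          ∎
    where
    open ≡-Reasoning
    ¬Rxy = proj₂ (∈-unrelated⁻ x V y∈)
    Ryz⇒¬Rxz : ∀ {z} → R y z → ¬ R x z
    Ryz⇒¬Rxz Ryz Rxz = ¬Rxy (R-trans Rxz (R-sym Ryz))

  unrelated-sizes : ∀ x V → ClassSizesBetween2And4 (x ∷ V) → ClassSizesBetween2And4 (unrelated x V)
  unrelated-sizes x V sizes y∈ = subst (λ ys → 2 ≤ length ys × length ys ≤ 4) (sym (class-unrelated x V y∈))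
                                        (sizes (there (proj₁ (∈-unrelated⁻ x V y∈))))

  module _ {x V} (x∷V! : Unique (x ∷ V))
           (2≤∣C∣ : 2 ≤ length (class x (x ∷ V))) (∣C∣≤4 : length (class x (x ∷ V)) ≤ 4)
           (F : CrossingFamily (unrelated x V)) where

    private
      module F = CrossingFamily F
      C = class x (x ∷ V)

      ∈C⁻ : ∀ {y} → y ∈ C → y ∈ x ∷ V × R x y
      ∈C⁻ = ∈-filter⁻ (R? x) {xs = x ∷ V}

      ∈F⇒¬R : ∀ {t y} → t ∈ F.members → y ∈ t → ¬ R x y
      ∈F⇒¬R t∈ y∈t = proj₂ (∈-unrelated⁻ x V (All.lookup F.⊆V t∈ y∈t))

    cons-members : List (List A)
    cons-members = cartesianProductWith _∷_ C F.members

    private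
      cons-⊆ : ∀ {y t} → y ∈ C → t ∈ F.members → y ∷ t ⊆ x ∷ V
      cons-⊆ y∈C t∈ (here refl) = proj₁ (∈C⁻ y∈C)
      cons-⊆ y∈C t∈ (there z∈t) = there (proj₁ (∈-unrelated⁻ x V (All.lookup F.⊆V t∈ z∈t)))

      cons-independent : ∀ {y t} → y ∈ C → t ∈ F.members → Independent (y ∷ t)
      cons-independent y∈C t∈ (here refl) (here refl) _   = refl
      cons-independent y∈C t∈ (here refl) (there b∈t) Ryb =
        contradiction (R-trans (proj₂ (∈C⁻ y∈C)) Ryb) (∈F⇒¬R t∈ b∈t)
      cons-independent y∈C t∈ (there a∈t) (here refl) Ray =
        contradiction (R-trans (proj₂ (∈C⁻ y∈C)) (R-sym Ray)) (∈F⇒¬R t∈ a∈t)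
      cons-independent y∈C t∈ (there a∈t) (there b∈t) Rab = All.lookup F.independent t∈ a∈t b∈t Rab

      heads-cross : ∀ {y y′} → y ∈ C → y′ ∈ C → y ≢ y′ → ∀ t t′ → Crossing (y ∷ t) (y′ ∷ t′)
      heads-cross y∈C y′∈C y≢y′ _ _ =
        _ , _ , here refl , here refl , R-trans (R-sym (proj₂ (∈C⁻ y∈C))) (proj₂ (∈C⁻ y′∈C)) , y≢y′

      tails-cross : ∀ {y} → y ∈ C → AllPairs (Crossing on (y ∷_)) F.members
      tails-cross _ =
        AllPairs.map (λ (a , b , a∈ , b∈ , Rab , a≢b) → a , b , there a∈ , there b∈ , Rab , a≢b) F.crossing

      ∣C∣+∣unrelated∣≡∣x∷V∣ : length C + length (unrelated x V) ≡ length (x ∷ V)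
      ∣C∣+∣unrelated∣≡∣x∷V∣ = begin
        length C + length (unrelated x V)
          ≡⟨ cong (λ ys → length ys + length (unrelated x V)) (filter-accept (R? x) R-refl) ⟩
        suc (length (class x V) + length (unrelated x V))
          ≡⟨ cong suc (length-filter+filter-∁ (R? x) V) ⟩
        length (x ∷ V)
          ∎
        where open ≡-Reasoning

      many : 2 ^ length (x ∷ V) ≤ length cons-members * length cons-members
      many = begin
        2 ^ length (x ∷ V)                     ≡⟨ cong (2 ^_) ∣C∣+∣unrelated∣≡∣x∷V∣ ⟨
        2 ^ (∣C∣ + length (unrelated x V))     ≡⟨ ^-distribˡ-+-* 2 ∣C∣ (length (unrelated x V)) ⟩
        2 ^ ∣C∣ * 2 ^ length (unrelated x V)   ≤⟨ *-mono-≤ (2^≤square ∣C∣ 2≤∣C∣ ∣C∣≤4) F.many ⟩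
        (∣C∣ * ∣C∣) * (∣F∣ * ∣F∣)              ≡⟨ [m*n]*[o*p]≡[m*o]*[n*p] ∣C∣ ∣C∣ ∣F∣ ∣F∣ ⟩
        (∣C∣ * ∣F∣) * (∣C∣ * ∣F∣)              ≡⟨ cong₂ _*_ ∣cons-members∣ ∣cons-members∣ ⟨
        length cons-members * length cons-members ∎
        where
        open ≤-Reasoning
        ∣C∣ = length C
        ∣F∣ = length F.members
        ∣cons-members∣ = length-cartesianProductWith _∷_ C F.members

    consFamily : CrossingFamily (x ∷ V)
    consFamily = record
      { members     = cons-members
      ; ⊆V          = All.tabulate λ T∈ → case-members (_⊆ x ∷ V) T∈ cons-⊆
      ; independent = All.tabulate λ T∈ → case-members Independent T∈ cons-independent
      ; crossing    = AllPairs-cartesianProductWith⁺ _∷_ (Unique.filter⁺ (R? x) x∷V!) heads-cross tails-cross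
      ; many        = many
      }
      where
      case-members : ∀ {ℓ} (P : List A → Set ℓ) {T} → T ∈ cons-members →
                     (∀ {y t} → y ∈ C → t ∈ F.members → P (y ∷ t)) → P T
      case-members P T∈ f with ∈-cartesianProductWith⁻ _∷_ C F.members T∈
      ... | _ , _ , y∈C , t∈ , refl = f y∈C t∈

  -- The members are the transversals of the classes: ∏ kᵢ of them for class sizes kᵢ, and
  -- 2 ^ kᵢ ≤ kᵢ * kᵢ as 2 ≤ kᵢ ≤ 4.  The fuel k is needed as unrelated x V is no subterm of x ∷ V.
  crossingFamily : ∀ k V → length V ≤ k → Unique V → ClassSizesBetween2And4 V → CrossingFamily V
  crossingFamily _ [] _ _ _ = record
    { members     = [] ∷ []
    ; ⊆V          = (λ ()) ∷ []
    ; independent = (λ ()) ∷ []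
    ; crossing    = [] ∷ []
    ; many        = ≤-refl
    }
  crossingFamily (suc k) (x ∷ V) (s≤s ∣V∣≤k) x∷V!@(_ ∷ V!) sizes =
    consFamily x∷V! (proj₁ (sizes (here refl))) (proj₂ (sizes (here refl)))
      (crossingFamily k (unrelated x V) (≤-trans (length-filter (∁? (R? x)) V) ∣V∣≤k)
                      (Unique.filter⁺ (∁? (R? x)) V!) (unrelated-sizes x V sizes))

module _ {n} {P : Pred (Fin n) p} (P? : Decidable P) where

  subset : Subset n
  subset = Vec.tabulate (does ∘ P?)

  ∈-subset⁺ : ∀ {x} → P x → x ∈ₛ subset
  ∈-subset⁺ {x} px = lookup⇒[]= x subset (trans (lookup∘tabulate (does ∘ P?) x) (dec-true (P? x) px))

  ∈-subset⁻ : ∀ {x} → x ∈ₛ subset → P x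
  ∈-subset⁻ {x} x∈ = decidable-stable (P? x) λ ¬px → false≢true (begin
    false                  ≡⟨ dec-false (P? x) ¬px ⟨
    does (P? x)            ≡⟨ lookup∘tabulate (does ∘ P?) x ⟨
    Vec.lookup subset x    ≡⟨ []=⇒lookup x∈ ⟩
    true                   ∎)
    where
    open ≡-Reasoning
    false≢true : false ≢ true
    false≢true ()

∈-allSubsets : ∀ {n} (S : Subset n) → S ∈ allSubsets n
∈-allSubsets Vec.[]                    = here refl
∈-allSubsets (inside Vec.∷ S)          = ∈-++⁺ˡ (∈-map⁺ (inside Vec.∷_) (∈-allSubsets S))
∈-allSubsets {suc n} (outside Vec.∷ S) =
  ∈-++⁺ʳ (map (inside Vec.∷_) (allSubsets n)) (∈-map⁺ (outside Vec.∷_) (∈-allSubsets S))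

module _ {n} {P : Subset n → Set} (P? : Decidable P) where

  -- The counter is local to the definition of countSubsets; unification recovers it.
  private
    counter : Σ[ count ∈ (List (Subset n) → ℕ) ] countSubsets P? ≡ count (allSubsets n)
    counter = count , unfold
      where
      count : List (Subset n) → ℕ
      count = _
      unfold : countSubsets P? ≡ count (allSubsets n)
      unfold with allSubsets n
      ... | _ = refl

    count≡length-filter : ∀ Ss → proj₁ counter Ss ≡ length (filter P? Ss)
    count≡length-filter []       = refl
    count≡length-filter (S ∷ Ss) with P? S
    ... | yes _ = cong suc (count≡length-filter Ss)
    ... | no _  = count≡length-filter Ss

  countSubsets≡length-filter : countSubsets P? ≡ length (filter P? (allSubsets n))
  countSubsets≡length-filter = trans (proj₂ counter) (count≡length-filter (allSubsets n))

module MaximalDistinctSumFreeSets {n} (_∙_ : Fin n → Fin n → Fin n) where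

  distinctSumFree-anti-mono : ∀ {S T} → S ⊆ₛ T → DistinctSumFree _∙_ T → DistinctSumFree _∙_ S
  distinctSumFree-anti-mono S⊆T T-free x y z x∈ y∈ z∈ = T-free x y z (S⊆T x∈) (S⊆T y∈) (S⊆T z∈)

  addGreedily : List (Fin n) → Subset n → Subset n
  addGreedily []       S = S
  addGreedily (x ∷ xs) S with distinctSumFree? _∙_ (S ∪ ⁅ x ⁆)
  ... | yes _ = addGreedily xs (S ∪ ⁅ x ⁆)
  ... | no _  = addGreedily xs S

  ⊆-addGreedily : ∀ xs S → S ⊆ₛ addGreedily xs S
  ⊆-addGreedily []       S x∈S = x∈S
  ⊆-addGreedily (x ∷ xs) S x∈S with distinctSumFree? _∙_ (S ∪ ⁅ x ⁆)
  ... | yes _ = ⊆-addGreedily xs (S ∪ ⁅ x ⁆) (p⊆p∪q ⁅ x ⁆ x∈S)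
  ... | no _  = ⊆-addGreedily xs S x∈S

  addGreedily-distinctSumFree : ∀ xs S → DistinctSumFree _∙_ S → DistinctSumFree _∙_ (addGreedily xs S)
  addGreedily-distinctSumFree []       S S-free = S-free
  addGreedily-distinctSumFree (x ∷ xs) S S-free with distinctSumFree? _∙_ (S ∪ ⁅ x ⁆)
  ... | yes S∪x-free = addGreedily-distinctSumFree xs (S ∪ ⁅ x ⁆) S∪x-free
  ... | no _         = addGreedily-distinctSumFree xs S S-free

  addGreedily-saturated : ∀ xs S {T} → addGreedily xs S ⊆ₛ T → DistinctSumFree _∙_ T →
                          ∀ {x} → x ∈ xs → x ∈ₛ T → x ∈ₛ addGreedily xs S
  addGreedily-saturated (x ∷ xs) S {T} ⊆T T-free (here refl) x∈T with distinctSumFree? _∙_ (S ∪ ⁅ x ⁆)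
  ... | yes _        = ⊆-addGreedily xs (S ∪ ⁅ x ⁆) (q⊆p∪q S ⁅ x ⁆ (x∈⁅x⁆ x))
  ... | no ¬S∪x-free = contradiction (distinctSumFree-anti-mono S∪x⊆T T-free) ¬S∪x-free
    where
    S∪x⊆T : S ∪ ⁅ x ⁆ ⊆ₛ T
    S∪x⊆T y∈ with x∈p∪q⁻ S ⁅ x ⁆ y∈
    ... | inj₁ y∈S = ⊆T (⊆-addGreedily xs S y∈S)
    ... | inj₂ y∈x = subst (_∈ₛ T) (sym (x∈⁅y⁆⇒x≡y x y∈x)) x∈T
  addGreedily-saturated (x ∷ xs) S ⊆T T-free (there y∈xs) y∈T with distinctSumFree? _∙_ (S ∪ ⁅ x ⁆)
  ... | yes _ = addGreedily-saturated xs (S ∪ ⁅ x ⁆) ⊆T T-free y∈xs y∈T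
  ... | no _  = addGreedily-saturated xs S ⊆T T-free y∈xs y∈T

  extension : Subset n → Subset n
  extension = addGreedily (allFin n)

  ⊆-extension : ∀ S → S ⊆ₛ extension S
  ⊆-extension = ⊆-addGreedily (allFin n)

  extension-maximal : ∀ {S} → DistinctSumFree _∙_ S → MaximalDistinctSumFree _∙_ (extension S)
  extension-maximal {S} S-free =
    addGreedily-distinctSumFree (allFin n) S S-free ,
    λ T ext⊆T T-free → ⊆-antisym (λ {x} → addGreedily-saturated (allFin n) S ext⊆T T-free (∈-allFin x)) ext⊆T

  Incompatible : Subset n → Subset n → Set
  Incompatible S S′ = ∀ M → S ⊆ₛ M → S′ ⊆ₛ M → ¬ DistinctSumFree _∙_ M

  length≤fStarMax : ∀ Ss → All (DistinctSumFree _∙_) Ss → AllPairs Incompatible Ss → length Ss ≤ fStarMax _∙_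
  length≤fStarMax Ss free incompatible = begin
    length Ss                     ≡⟨ length-map extension Ss ⟨
    length (map extension Ss)     ≤⟨ Unique⇒length-mono-⊆ (≡-dec _≟ᵇ_) extensions-distinct extensions-maximal ⟩
    length (filter (maximalDistinctSumFree? _∙_) (allSubsets n))
                                  ≡⟨ countSubsets≡length-filter (maximalDistinctSumFree? _∙_) ⟨
    fStarMax _∙_                  ∎
    where
    open ≤-Reasoning
    distinct : ∀ {S S′} → DistinctSumFree _∙_ S → DistinctSumFree _∙_ S′ → Incompatible S S′ →
               extension S ≢ extension S′
    distinct {S} {S′} S-free _ S⊥S′ eq = S⊥S′ (extension S) (⊆-extension S)
      (subst (S′ ⊆ₛ_) (sym eq) (⊆-extension S′)) (proj₁ (extension-maximal S-free))
    extensions-distinct : Unique (map extension Ss)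
    extensions-distinct = AllPairs.map⁺ (AllPairs-zipWith-All distinct free incompatible)
    extensions-maximal : map extension Ss ⊆ filter (maximalDistinctSumFree? _∙_) (allSubsets n)
    extensions-maximal M∈ with ∈-map⁻ extension M∈
    ... | S , S∈ , refl =
      ∈-filter⁺ (maximalDistinctSumFree? _∙_) (∈-allSubsets _) (extension-maximal (All.lookup free S∈))

module _ {n} (ι : Fin n → Fin n) (ι-involutive : ∀ x → ι (ι x) ≡ x) where

  private
    fixed? : Decidable (λ x → ι x ≡ x)
    fixed? x = ι x Fin.≟ x

  fixedPoints : List (Fin n)
  fixedPoints = filter fixed? (allFin n)

  -- Moved points pair up as {x , ι x}; the order of Fin n picks one point from each pair.
  even-fixedPoints : 2 ∣ n → 2 ∣ length fixedPoints
  even-fixedPoints 2∣n = ∣m+n∣m⇒∣n (subst (2 ∣_) n≡∣moved∣+∣fixed∣ 2∣n) (divides (length up) ∣moved∣≡∣up∣*2)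
    where
    moved = filter (∁? fixed?) (allFin n)
    up    = filter (λ x → x Fin.<? ι x) moved
    down  = filter (∁? (λ x → x Fin.<? ι x)) moved

    ι-injective : ∀ {x y} → ι x ≡ ι y → x ≡ y
    ι-injective {x} {y} ιx≡ιy = trans (sym (ι-involutive x)) (trans (cong ι ιx≡ιy) (ι-involutive y))

    ∈-moved⁻ : ∀ {x} → x ∈ moved → ι x ≢ x
    ∈-moved⁻ x∈ = proj₂ (∈-filter⁻ (∁? fixed?) {xs = allFin n} x∈)

    ι-∈-moved : ∀ {x} → ι x ≢ x → ι x ∈ moved
    ι-∈-moved ιx≢x = ∈-filter⁺ (∁? fixed?) (∈-allFin _) (λ ιιx≡ιx → ιx≢x (trans (sym ιιx≡ιx) (ι-involutive _)))

    ι[up]⊆down : map ι up ⊆ down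
    ι[up]⊆down y∈ with ∈-map⁻ ι y∈
    ... | x , x∈up , refl with ∈-filter⁻ _ {xs = moved} x∈up
    ...   | x∈moved , x<ιx = ∈-filter⁺ _ (ι-∈-moved (∈-moved⁻ x∈moved))
                               (λ ιx<ιιx → Fin.<-asym x<ιx (subst (ι x <ᶠ_) (ι-involutive x) ιx<ιιx))

    ι[down]⊆up : map ι down ⊆ up
    ι[down]⊆up y∈ with ∈-map⁻ ι y∈
    ... | x , x∈down , refl with ∈-filter⁻ _ {xs = moved} x∈down
    ...   | x∈moved , x≮ιx with Fin.<-cmp x (ι x)
    ...     | tri< x<ιx _ _  = contradiction x<ιx x≮ιx
    ...     | tri≈ _ x≡ιx _  = contradiction (sym x≡ιx) (∈-moved⁻ x∈moved)
    ...     | tri> _ _ ιx<x  =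
      ∈-filter⁺ _ (ι-∈-moved (∈-moved⁻ x∈moved)) (subst (ι x <ᶠ_) (sym (ι-involutive x)) ιx<x)

    ∣up∣≡∣down∣ : length up ≡ length down
    ∣up∣≡∣down∣ = ≤-antisym
      (≤-trans (≤-reflexive (sym (length-map ι up)))
               (Unique⇒length-mono-⊆ Fin._≟_ (Unique.map⁺ ι-injective (Unique.filter⁺ _ moved!)) ι[up]⊆down))
      (≤-trans (≤-reflexive (sym (length-map ι down)))
               (Unique⇒length-mono-⊆ Fin._≟_ (Unique.map⁺ ι-injective (Unique.filter⁺ _ moved!)) ι[down]⊆up))
      where
      moved! : Unique moved
      moved! = Unique.filter⁺ (∁? fixed?) (Unique.allFin⁺ n)

    ∣moved∣≡∣up∣*2 : length moved ≡ length up * 2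
    ∣moved∣≡∣up∣*2 = begin
      length moved                ≡⟨ length-filter+filter-∁ (λ x → x Fin.<? ι x) moved ⟨
      length up + length down     ≡⟨ cong (length up +_) ∣up∣≡∣down∣ ⟨
      length up + length up       ≡⟨ cong (length up +_) (+-identityʳ (length up)) ⟨
      2 * length up               ≡⟨ *-comm 2 (length up) ⟩
      length up * 2               ∎
      where open ≡-Reasoning

    n≡∣moved∣+∣fixed∣ : n ≡ length moved + length fixedPoints
    n≡∣moved∣+∣fixed∣ = begin
      n                                    ≡⟨ length-tabulate (λ x → x) ⟨
      length (allFin n)                    ≡⟨ length-filter+filter-∁ fixed? (allFin n) ⟨
      length fixedPoints + length moved    ≡⟨ +-comm (length fixedPoints) (length moved) ⟩
      length moved + length fixedPoints    ∎
      where open ≡-Reasoning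

module FiniteAbelianGroup {n} {_∙_ : Fin n → Fin n → Fin n} {ε : Fin n} {_⁻¹ : Fin n → Fin n}
                          (isAbelianGroup : IsAbelianGroup _≡_ _∙_ ε _⁻¹) where

  open IsGroup (IsAbelianGroup.isGroup isAbelianGroup) public using (_\\_)
  open IsAbelianGroup isAbelianGroup public using (assoc; comm; identityˡ; identityʳ; inverseˡ; inverseʳ)

  abelianGroup : AbelianGroup 0ℓ 0ℓ
  abelianGroup = record { isAbelianGroup = isAbelianGroup }

  open AbelianGroupProperties abelianGroup public
    using (⁻¹-involutive; ⁻¹-∙-comm; ε⁻¹≈ε; inverseʳ-unique; \\-leftDividesˡ; \\-leftDividesʳ; ∙-cancelˡ)
  open CommutativeSemigroupProperties (AbelianGroup.commutativeSemigroup abelianGroup) public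
    using (interchange; x∙yz≈y∙xz)

  ∃-involution : 2 ∣ n → ∃ λ c → c ≢ ε × c ∙ c ≡ ε
  ∃-involution 2∣n with Fin.any? (λ c → ¬? (c Fin.≟ ε) ×-dec (c ⁻¹ Fin.≟ c))
  ... | yes (c , c≢ε , c⁻¹≡c) = c , c≢ε , subst (λ d → c ∙ d ≡ ε) c⁻¹≡c (inverseʳ c)
  ... | no ∄c = contradiction (∣1⇒≡1 (subst (2 ∣_) ∣fixed∣≡1 (even-fixedPoints _⁻¹ ⁻¹-involutive 2∣n))) λ ()
    where
    fixed = fixedPoints _⁻¹ ⁻¹-involutive
    fixed! : Unique fixed
    fixed! = Unique.filter⁺ _ (Unique.allFin⁺ n)
    fixed⊆ε : fixed ⊆ ε ∷ []
    fixed⊆ε {x} x∈ = here (decidable-stable (x Fin.≟ ε) λ x≢ε →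
      ∄c (x , x≢ε , proj₂ (∈-filter⁻ _ {xs = allFin n} x∈)))
    ∣fixed∣≡1 : length fixed ≡ 1
    ∣fixed∣≡1 = ≤-antisym
      (Unique⇒length-mono-⊆ Fin._≟_ fixed! fixed⊆ε)
      (Unique⇒length-mono-⊆ Fin._≟_ ([] ∷ []) λ { (here refl) → ∈-filter⁺ _ (∈-allFin ε) ε⁻¹≈ε })

  square? : Decidable (λ z → ∃ λ x → x ∙ x ≡ z)
  square? z = Fin.any? (λ x → x ∙ x Fin.≟ z)

  -- Squaring identifies c with ε, so its image misses a point.
  involution⇒nonSquare : ∀ {c} → c ≢ ε → c ∙ c ≡ ε → ∃ λ g → ∀ x → x ∙ x ≢ g
  involution⇒nonSquare {c} c≢ε c∙c≡ε with Fin.any? (λ g → Fin.all? (λ x → ¬? (x ∙ x Fin.≟ g)))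
  ... | yes nonSquare = nonSquare
  ... | no ∄g = contradiction n<n (<-irrefl refl)
    where
    ≢c? : Decidable (_≢ c)
    ≢c? x = ¬? (x Fin.≟ c)
    square : Fin n → Fin n
    square x = x ∙ x
    squares≠c = map square (filter ≢c? (allFin n))
    root : ∀ z → ∃ λ x → x ∙ x ≡ z
    root z = decidable-stable (square? z) λ ∄x → ∄g (z , λ x x∙x≡z → ∄x (x , x∙x≡z))
    all⊆squares≠c : allFin n ⊆ squares≠c
    all⊆squares≠c {z} _ with root z
    ... | x , refl with x Fin.≟ c
    ...   | no x≢c   = ∈-map⁺ square (∈-filter⁺ ≢c? (∈-allFin x) x≢c)
    ...   | yes refl = subst (_∈ squares≠c) (trans (identityˡ ε) (sym c∙c≡ε))
                             (∈-map⁺ square (∈-filter⁺ ≢c? (∈-allFin ε) (c≢ε ∘ sym)))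
    n<n : n < n
    n<n = begin-strict
      n                               ≡⟨ length-tabulate (λ x → x) ⟨
      length (allFin n)               ≤⟨ Unique⇒length-mono-⊆ Fin._≟_ (Unique.allFin⁺ n) all⊆squares≠c ⟩
      length squares≠c                ≡⟨ length-map square (filter ≢c? (allFin n)) ⟩
      length (filter ≢c? (allFin n))  <⟨ filter-notAll ≢c? (allFin n) (Any.map (λ { refl ¬c≡c → ¬c≡c refl }) (∈-allFin c)) ⟩
      length (allFin n)               ≡⟨ length-tabulate (λ x → x) ⟩
      n                               ∎
      where open ≤-Reasoning

  ∃-nonSquare : 2 ∣ n → ∃ λ g → ∀ x → x ∙ x ≢ g
  ∃-nonSquare 2∣n = let _ , c≢ε , c∙c≡ε = ∃-involution 2∣n in involution⇒nonSquare c≢ε c∙c≡ε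

  record ProperSubgroup⊇Squares (K : Subset n) : Set where
    field
      ∙-closed : ∀ {x y} → x ∈ₛ K → y ∈ₛ K → x ∙ y ∈ₛ K
      square∈  : ∀ x → x ∙ x ∈ₛ K
      proper   : ∃ (_∉ₛ K)

    ε∈ : ε ∈ₛ K
    ε∈ = subst (_∈ₛ K) (identityˡ ε) (square∈ ε)

    ⁻¹-closed : ∀ {x} → x ∈ₛ K → x ⁻¹ ∈ₛ K
    ⁻¹-closed {x} x∈ = subst (_∈ₛ K) (\\-leftDividesˡ x (x ⁻¹)) (∙-closed x∈ (square∈ (x ⁻¹)))

    ∉-⁻¹ : ∀ {a} → a ∉ₛ K → a ⁻¹ ∉ₛ K
    ∉-⁻¹ {a} a∉ a⁻¹∈ = a∉ (subst (_∈ₛ K) (⁻¹-involutive a) (⁻¹-closed a⁻¹∈))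

    ∈∙∉⇒∉ : ∀ {h a} → h ∈ₛ K → a ∉ₛ K → h ∙ a ∉ₛ K
    ∈∙∉⇒∉ {h} {a} h∈ a∉ ha∈ = a∉ (subst (_∈ₛ K) (\\-leftDividesʳ h a) (∙-closed (⁻¹-closed h∈) ha∈))

    ∣K∣<n : ∣ K ∣ < n
    ∣K∣<n = subst (∣ K ∣ <_) (∣⊤∣≡n n) (p⊂q⇒∣p∣<∣q∣ ((λ _ → ∈⊤) , proj₁ proper , ∈⊤ , proj₂ proper))

  IndexTwo : Subset n → Set
  IndexTwo H = ProperSubgroup⊇Squares H × (∀ {a b} → a ∉ₛ H → b ∉ₛ H → a ∙ b ∈ₛ H)

  squares : Subset n
  squares = subset square?

  squares-proper : 2 ∣ n → ProperSubgroup⊇Squares squares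
  squares-proper 2∣n = record
    { ∙-closed = λ x∈ y∈ → product (∈-subset⁻ square? x∈) (∈-subset⁻ square? y∈)
    ; square∈  = λ x → ∈-subset⁺ square? (x , refl)
    ; proper   = let g , nonSquare = ∃-nonSquare 2∣n in
                 g , λ g∈ → let x , x∙x≡g = ∈-subset⁻ square? g∈ in nonSquare x x∙x≡g
    }
    where
    product : ∀ {x y} → ∃ (λ u → u ∙ u ≡ x) → ∃ (λ v → v ∙ v ≡ y) → x ∙ y ∈ₛ squares
    product (u , refl) (v , refl) = ∈-subset⁺ square? (u ∙ v , interchange u v u v)

  -- As a ∙ a ∈ K, K ∪ aK is again closed under ∙; it misses b because a ∙ b ∉ K.
  module _ {K : Subset n} (K-proper : ProperSubgroup⊇Squares K) {a b : Fin n}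
           (a∉K : a ∉ₛ K) (b∉K : b ∉ₛ K) (ab∉K : a ∙ b ∉ₛ K) where

    open ProperSubgroup⊇Squares K-proper

    private
      K∪aK? : Decidable (λ x → x ∈ₛ K ⊎ a \\ x ∈ₛ K)
      K∪aK? x = (x ∈? K) ⊎-dec (a \\ x ∈? K)

    K∪aK : Subset n
    K∪aK = subset K∪aK?

    K∪aK-proper : ProperSubgroup⊇Squares K∪aK
    K∪aK-proper = record
      { ∙-closed = λ x∈ y∈ → ∈-subset⁺ K∪aK? (product (∈-subset⁻ K∪aK? x∈) (∈-subset⁻ K∪aK? y∈))
      ; square∈  = λ x → ∈-subset⁺ K∪aK? (inj₁ (square∈ x))
      ; proper   = b , λ b∈ → [ b∉K , a\\b∉K ]′ (∈-subset⁻ K∪aK? b∈)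
      }
      where
      product : ∀ {x y} → x ∈ₛ K ⊎ a \\ x ∈ₛ K → y ∈ₛ K ⊎ a \\ y ∈ₛ K → x ∙ y ∈ₛ K ⊎ a \\ (x ∙ y) ∈ₛ K
      product         (inj₁ x∈) (inj₁ y∈) = inj₁ (∙-closed x∈ y∈)
      product {x} {y} (inj₁ x∈) (inj₂ y∈) = inj₂ (subst (_∈ₛ K) (x∙yz≈y∙xz x (a ⁻¹) y) (∙-closed x∈ y∈))
      product {x} {y} (inj₂ x∈) (inj₁ y∈) = inj₂ (subst (_∈ₛ K) (assoc (a ⁻¹) x y) (∙-closed x∈ y∈))
      product {x} {y} (inj₂ x∈) (inj₂ y∈) = inj₁ (subst (_∈ₛ K) eq (∙-closed (square∈ a) (∙-closed x∈ y∈)))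
        where
        eq : (a ∙ a) ∙ ((a \\ x) ∙ (a \\ y)) ≡ x ∙ y
        eq = trans (interchange a a (a \\ x) (a \\ y)) (cong₂ _∙_ (\\-leftDividesˡ a x) (\\-leftDividesˡ a y))
      a\\b∉K : a \\ b ∉ₛ K
      a\\b∉K a\\b∈K = ab∉K (subst (_∈ₛ K) eq (∙-closed (square∈ a) a\\b∈K))
        where
        eq : (a ∙ a) ∙ (a \\ b) ≡ a ∙ b
        eq = trans (assoc a a (a \\ b)) (cong (a ∙_) (\\-leftDividesˡ a b))

    ∣K∣<∣K∪aK∣ : ∣ K ∣ < ∣ K∪aK ∣
    ∣K∣<∣K∪aK∣ = p⊂q⇒∣p∣<∣q∣
      ( (λ x∈ → ∈-subset⁺ K∪aK? (inj₁ x∈))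
      , a , ∈-subset⁺ K∪aK? (inj₂ (subst (_∈ₛ K) (sym (inverseˡ a)) ε∈)) , a∉K )

  indexTwo-above : ∀ k K → ProperSubgroup⊇Squares K → n ≤ k + ∣ K ∣ → ∃ IndexTwo
  indexTwo-above zero K K-proper n≤∣K∣ = contradiction n≤∣K∣ (<⇒≱ (ProperSubgroup⊇Squares.∣K∣<n K-proper))
  indexTwo-above (suc k) K K-proper n≤1+k+∣K∣
    with Fin.any? (λ a → Fin.any? (λ b → ¬? (a ∈? K) ×-dec ¬? (b ∈? K) ×-dec ¬? (a ∙ b ∈? K)))
  ... | yes (a , b , a∉K , b∉K , ab∉K) = indexTwo-above k K′ (K∪aK-proper K-proper a∉K b∉K ab∉K) (begin
    n              ≤⟨ n≤1+k+∣K∣ ⟩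
    suc k + ∣ K ∣  ≡⟨ +-suc k ∣ K ∣ ⟨
    k + suc ∣ K ∣  ≤⟨ +-monoʳ-≤ k (∣K∣<∣K∪aK∣ K-proper a∉K b∉K ab∉K) ⟩
    k + ∣ K′ ∣     ∎)
    where
    open ≤-Reasoning
    K′ = K∪aK K-proper a∉K b∉K ab∉K
  ... | no ∄ab = K , K-proper , λ {a} {b} a∉K b∉K →
    decidable-stable (a ∙ b ∈? K) λ ab∉K → ∄ab (a , b , a∉K , b∉K , ab∉K)

  ∃-indexTwo : 2 ∣ n → ∃ IndexTwo
  ∃-indexTwo 2∣n = indexTwo-above n squares (squares-proper 2∣n) (m≤m+n n ∣ squares ∣)

  ∃-involutionIn : ∀ K → ε ∈ₛ K →
                   ∃ λ c → c ∈ₛ K × c ∙ c ≡ ε × (c ≡ ε → ∀ {h} → h ∈ₛ K → h ∙ h ≡ ε → h ≡ ε)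
  ∃-involutionIn K ε∈K with Fin.any? (λ c → (c ∈? K) ×-dec ¬? (c Fin.≟ ε) ×-dec (c ∙ c Fin.≟ ε))
  ... | yes (c , c∈K , c≢ε , c∙c≡ε) = c , c∈K , c∙c≡ε , λ c≡ε → contradiction c≡ε c≢ε
  ... | no ∄c = ε , ε∈K , identityˡ ε , λ _ {h} h∈K h∙h≡ε →
    decidable-stable (h Fin.≟ ε) λ h≢ε → ∄c (h , h∈K , h≢ε , h∙h≡ε)

module SumFreeConstruction
  {n} {_∙_ : Fin n → Fin n → Fin n} {ε : Fin n} {_⁻¹ : Fin n → Fin n}
  (isAbelianGroup : IsAbelianGroup _≡_ _∙_ ε _⁻¹)
  {H : Subset n} (H-indexTwo : FiniteAbelianGroup.IndexTwo isAbelianGroup H)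
  {c : Fin n} (c∈H : c ∈ₛ H) (c∙c≡ε : c ∙ c ≡ ε)
  (c-nontrivial : c ≡ ε → ∀ {h} → h ∈ₛ H → h ∙ h ≡ ε → h ≡ ε)
  where

  open FiniteAbelianGroup isAbelianGroup
  open ProperSubgroup⊇Squares (proj₁ H-indexTwo)
  open DecMembership (Fin._≟_ {n}) using () renaming (_∈?_ to _∈ᶠ?_)
  open MaximalDistinctSumFreeSets _∙_

  ∉∙∉⇒∈ : ∀ {a b} → a ∉ₛ H → b ∉ₛ H → a ∙ b ∈ₛ H
  ∉∙∉⇒∈ = proj₂ H-indexTwo

  ∉⇒≢∈ : ∀ {a h} → a ∉ₛ H → h ∈ₛ H → a ≢ h
  ∉⇒≢∈ a∉H h∈H refl = a∉H h∈H

  c^ : Bool → Fin n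
  c^ false = ε
  c^ true  = c

  c^∈H : ∀ b → c^ b ∈ₛ H
  c^∈H false = ε∈
  c^∈H true  = c∈H

  c^-∙ : ∀ b b′ → c^ b ∙ c^ b′ ≡ c^ (b xor b′)
  c^-∙ false b′    = identityˡ (c^ b′)
  c^-∙ true  false = identityʳ c
  c^-∙ true  true  = c∙c≡ε

  inv^ : Bool → Fin n → Fin n
  inv^ false x = x
  inv^ true  x = x ⁻¹

  inv^-∙ : ∀ a x y → inv^ a (x ∙ y) ≡ inv^ a x ∙ inv^ a y
  inv^-∙ false x y = refl
  inv^-∙ true  x y = sym (⁻¹-∙-comm x y)

  inv^-inv^ : ∀ a a′ x → inv^ a (inv^ a′ x) ≡ inv^ (a xor a′) x
  inv^-inv^ false a′    x = refl
  inv^-inv^ true  false x = refl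
  inv^-inv^ true  true  x = ⁻¹-involutive x

  inv^-c^ : ∀ a b → inv^ a (c^ b) ≡ c^ b
  inv^-c^ false b     = refl
  inv^-c^ true  false = ε⁻¹≈ε
  inv^-c^ true  true  = sym (inverseʳ-unique c c c∙c≡ε)

  act : Bool → Bool → Fin n → Fin n
  act a b x = inv^ a x ∙ c^ b

  act-act : ∀ a b a′ b′ x → act a b (act a′ b′ x) ≡ act (a xor a′) (b′ xor b) x
  act-act a b a′ b′ x = begin
    inv^ a (inv^ a′ x ∙ c^ b′) ∙ c^ b              ≡⟨ cong (_∙ c^ b) (inv^-∙ a (inv^ a′ x) (c^ b′)) ⟩
    (inv^ a (inv^ a′ x) ∙ inv^ a (c^ b′)) ∙ c^ b   ≡⟨ cong₂ (λ u v → (u ∙ v) ∙ c^ b) (inv^-inv^ a a′ x)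
                                                                                  (inv^-c^ a b′) ⟩
    (inv^ (a xor a′) x ∙ c^ b′) ∙ c^ b             ≡⟨ assoc (inv^ (a xor a′) x) (c^ b′) (c^ b) ⟩
    inv^ (a xor a′) x ∙ (c^ b′ ∙ c^ b)             ≡⟨ cong (inv^ (a xor a′) x ∙_) (c^-∙ b′ b) ⟩
    act (a xor a′) (b′ xor b) x                    ∎
    where open ≡-Reasoning

  act-involutive : ∀ a b x → act a b (act a b x) ≡ x
  act-involutive a b x = begin
    act a b (act a b x)          ≡⟨ act-act a b a b x ⟩
    act (a xor a) (b xor b) x    ≡⟨ cong₂ (λ a′ b′ → act a′ b′ x) (xor-same a) (xor-same b) ⟩
    x ∙ ε                        ≡⟨ identityʳ x ⟩
    x                            ∎
    where open ≡-Reasoning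

  act-∉H : ∀ a b {x} → x ∉ₛ H → act a b x ∉ₛ H
  act-∉H false b x∉H = subst (_∉ₛ H) (comm (c^ b) _) (∈∙∉⇒∉ (c^∈H b) x∉H)
  act-∉H true  b x∉H = subst (_∉ₛ H) (comm (c^ b) _) (∈∙∉⇒∉ (c^∈H b) (∉-⁻¹ x∉H))

  Related : Fin n → Fin n → Set
  Related x y = ∃₂ λ a b → y ≡ act a b x

  Related-isEquivalence : IsEquivalence Related
  Related-isEquivalence = record
    { refl  = λ {x} → false , false , sym (identityʳ x)
    ; sym   = λ { {x} (a , b , refl) → a , b , sym (act-involutive a b x) }
    ; trans = λ { {x} (a , b , refl) (a′ , b′ , refl) → a′ xor a , b xor b′ , act-act a′ b′ a b x }
    }

  orbit : Fin n → List (Fin n)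
  orbit x = act false false x ∷ act true false x ∷ act false true x ∷ act true true x ∷ []

  Related⇒∈orbit : ∀ {x y} → Related x y → y ∈ orbit x
  Related⇒∈orbit (false , false , refl) = here refl
  Related⇒∈orbit (true  , false , refl) = there (here refl)
  Related⇒∈orbit (false , true  , refl) = there (there (here refl))
  Related⇒∈orbit (true  , true  , refl) = there (there (there (here refl)))

  ∈orbit⇒Related : ∀ {x y} → y ∈ orbit x → Related x y
  ∈orbit⇒Related (here y≡)                        = false , false , y≡
  ∈orbit⇒Related (there (here y≡))                = true  , false , y≡
  ∈orbit⇒Related (there (there (here y≡)))        = false , true  , y≡
  ∈orbit⇒Related (there (there (there (here y≡)))) = true  , true  , y≡

  related? : Decidable₂ Related
  related? x y = Dec.map′ ∈orbit⇒Related Related⇒∈orbit (y ∈ᶠ? orbit x)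

  open PartialTransversals related? Related-isEquivalence

  -- Excludes the singleton orbits {x}, which occur only if c = ε and x⁻¹ = x.
  InV : Fin n → Set
  InV x = x ∉ₛ H × (c ≢ ε ⊎ x ⁻¹ ≢ x)

  inV? : Decidable InV
  inV? x = ¬? (x ∈? H) ×-dec (¬? (c Fin.≟ ε) ⊎-dec ¬? (x ⁻¹ Fin.≟ x))

  V : List (Fin n)
  V = filter inV? (allFin n)

  V! : Unique V
  V! = Unique.filter⁺ inV? (Unique.allFin⁺ n)

  ∈V⁺ : ∀ {x} → InV x → x ∈ V
  ∈V⁺ = ∈-filter⁺ inV? (∈-allFin _)

  ∈V⁻ : ∀ {x} → x ∈ V → InV x
  ∈V⁻ x∈V = proj₂ (∈-filter⁻ inV? {xs = allFin n} x∈V)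

  partner : ∀ {x} → InV x → ∃ λ y → y ∈ V × x ≢ y × Related x y
  partner {x} (x∉H , inj₁ c≢ε) =
    x ∙ c , ∈V⁺ (act-∉H false true x∉H , inj₁ c≢ε) ,
    (λ x≡xc → c≢ε (∙-cancelˡ x c ε (trans (sym x≡xc) (sym (identityʳ x))))) , false , true , refl
  partner {x} (x∉H , inj₂ x⁻¹≢x) =
    x ⁻¹ , ∈V⁺ (∉-⁻¹ x∉H , inj₂ λ x⁻¹⁻¹≡x⁻¹ → x⁻¹≢x (trans (sym x⁻¹⁻¹≡x⁻¹) (⁻¹-involutive x))) ,
    (λ x≡x⁻¹ → x⁻¹≢x (sym x≡x⁻¹)) , true , false , sym (identityʳ (x ⁻¹))

  V-classSizes : ClassSizesBetween2And4 V
  V-classSizes {x} x∈V with partner (∈V⁻ x∈V)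
  ... | y , y∈V , x≢y , Rxy = 2≤∣class∣ , ∣class∣≤4
    where
    class! : Unique (class x V)
    class! = Unique.filter⁺ (related? x) V!
    2≤∣class∣ = Unique⇒length-mono-⊆ Fin._≟_ ((x≢y ∷ []) ∷ [] ∷ []) λ
      { (here refl)         → ∈-filter⁺ (related? x) x∈V (IsEquivalence.refl Related-isEquivalence)
      ; (there (here refl)) → ∈-filter⁺ (related? x) y∈V Rxy
      }
    ∣class∣≤4 = Unique⇒length-mono-⊆ Fin._≟_ class! λ y∈ →
      Related⇒∈orbit (proj₂ (∈-filter⁻ (related? x) {xs = V} y∈))

  S : List (Fin n) → Subset n
  S T = subset (_∈ᶠ? ε ∷ c ∷ T)

  ∈S⁺ : ∀ {T x} → x ∈ ε ∷ c ∷ T → x ∈ₛ S T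
  ∈S⁺ {T} = ∈-subset⁺ (_∈ᶠ? ε ∷ c ∷ T)

  ∈S⁻ : ∀ {T x} → x ∈ₛ S T → x ∈ ε ∷ c ∷ T
  ∈S⁻ {T} = ∈-subset⁻ (_∈ᶠ? ε ∷ c ∷ T)

  c^∈S : ∀ {T} b → c^ b ∈ₛ S T
  c^∈S {T} false = ∈S⁺ {T} (here refl)
  c^∈S {T} true  = ∈S⁺ {T} (there (here refl))

  ∈T⇒∈S : ∀ {T x} → x ∈ T → x ∈ₛ S T
  ∈T⇒∈S x∈T = ∈S⁺ (there (there x∈T))

  module _ {T} (T⊆V : T ⊆ V) where

    ∈T⇒∉H : ∀ {x} → x ∈ T → x ∉ₛ H
    ∈T⇒∉H x∈T = proj₁ (∈V⁻ (T⊆V x∈T))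

    ∈S∩H⇒c^ : ∀ {x} → x ∈ₛ S T → x ∈ₛ H → ∃ λ b → x ≡ c^ b
    ∈S∩H⇒c^ x∈S x∈H with ∈S⁻ x∈S
    ... | here x≡ε                = false , x≡ε
    ... | there (here x≡c)        = true , x≡c
    ... | there (there x∈T)       = contradiction x∈H (∈T⇒∉H x∈T)

    ∈S∖H⇒∈T : ∀ {x} → x ∈ₛ S T → x ∉ₛ H → x ∈ T
    ∈S∖H⇒∈T x∈S x∉H with ∈S⁻ x∈S
    ... | here refl               = contradiction ε∈ x∉H
    ... | there (here refl)       = contradiction c∈H x∉H
    ... | there (there x∈T)       = x∈T

    S-distinctSumFree : Independent T → DistinctSumFree _∙_ (S T)
    S-distinctSumFree indep x y z x∈S y∈S z∈S = sumFree (∈S⁻ x∈S) (∈S⁻ y∈S) z∈S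
      where
      sumFree : ∀ {x y z} → x ∈ ε ∷ c ∷ T → y ∈ ε ∷ c ∷ T → z ∈ₛ S T → x ≢ y → y ≢ z → x ≢ z → x ∙ y ≢ z
      sumFree {y = y} (here refl) _ _ _ y≢z _ εy≡z = y≢z (trans (sym (identityˡ y)) εy≡z)
      sumFree {x = x} _ (here refl) _ _ _ x≢z xε≡z = x≢z (trans (sym (identityʳ x)) xε≡z)
      sumFree (there (here refl)) (there (here refl)) _ c≢c _ _ _ = c≢c refl
      sumFree {y = y} (there (here refl)) (there (there y∈T)) z∈S _ y≢z _ refl =
        y≢z (indep y∈T (∈S∖H⇒∈T z∈S (∈∙∉⇒∉ c∈H (∈T⇒∉H y∈T))) (false , true , comm c y))
      sumFree (there (there x∈T)) (there (here refl)) z∈S _ _ x≢z refl =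
        x≢z (indep x∈T (∈S∖H⇒∈T z∈S (act-∉H false true (∈T⇒∉H x∈T))) (false , true , refl))
      sumFree {x = x} {y} (there (there x∈T)) (there (there y∈T)) z∈S x≢y _ _ refl
        with ∈S∩H⇒c^ z∈S (∉∙∉⇒∈ (∈T⇒∉H x∈T) (∈T⇒∉H y∈T))
      ... | b , xy≡c^b =
        x≢y (indep x∈T y∈T (true , b , trans (sym (\\-leftDividesʳ x y)) (cong (x \\_) xy≡c^b)))

  crossing⇒incompatible : ∀ {T T′} → T ⊆ V → T′ ⊆ V → Crossing T T′ → Incompatible (S T) (S T′)
  crossing⇒incompatible {T} {T′} T⊆V T′⊆V (a , b , a∈T , b∈T′ , (α , β , b≡) , a≢b) M ST⊆M ST′⊆M M-free =
    schur α b≡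
    where
    a∉H = ∈T⇒∉H T⊆V a∈T
    b∉H = ∈T⇒∉H T′⊆V b∈T′
    a∈M = ST⊆M (∈T⇒∈S a∈T)
    b∈M = ST′⊆M (∈T⇒∈S b∈T′)
    c^β∈M = ST⊆M (c^∈S {T} β)
    schur : ∀ α → b ≡ act α β a → ⊥
    schur false b≡ = M-free a (c^ β) b a∈M c^β∈M b∈M
      (∉⇒≢∈ a∉H (c^∈H β)) (λ c^β≡b → ∉⇒≢∈ b∉H (c^∈H β) (sym c^β≡b)) a≢b (sym b≡)
    schur true b≡ = M-free a b (c^ β) a∈M b∈M c^β∈M
      a≢b (∉⇒≢∈ b∉H (c^∈H β)) (∉⇒≢∈ a∉H (c^∈H β)) (trans (cong (a ∙_) b≡) (\\-leftDividesˡ a (c^ β)))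

  private
    inH  = filter (_∈? H) (allFin n)
    outH = filter (∁? (_∈? H)) (allFin n)

    SelfInverseOutside : Fin n → Set
    SelfInverseOutside x = c ≡ ε × x ∉ₛ H × x ⁻¹ ≡ x

    selfInverseOutside? : Decidable SelfInverseOutside
    selfInverseOutside? x = (c Fin.≟ ε) ×-dec ¬? (x ∈? H) ×-dec (x ⁻¹ Fin.≟ x)

    I = filter selfInverseOutside? (allFin n)

  ∣inH∣≤∣outH∣ : length inH ≤ length outH
  ∣inH∣≤∣outH∣ = begin
    length inH              ≡⟨ length-map (g ∙_) inH ⟨
    length (map (g ∙_) inH) ≤⟨ Unique⇒length-mono-⊆ Fin._≟_ g[inH]! g[inH]⊆outH ⟩
    length outH             ∎
    where
    open ≤-Reasoning
    g = proj₁ proper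
    g[inH]! : Unique (map (g ∙_) inH)
    g[inH]! = Unique.map⁺ (∙-cancelˡ g _ _) (Unique.filter⁺ _ (Unique.allFin⁺ n))
    g[inH]⊆outH : map (g ∙_) inH ⊆ outH
    g[inH]⊆outH y∈ with ∈-map⁻ (g ∙_) y∈
    ... | h , h∈inH , refl = ∈-filter⁺ (∁? (_∈? H)) (∈-allFin _)
      (subst (_∉ₛ H) (comm h g) (∈∙∉⇒∉ (proj₂ (∈-filter⁻ (_∈? H) {xs = allFin n} h∈inH)) (proj₂ proper)))

  -- Two distinct self-inverse a, b ∉ H would give the involution a ∙ b ≠ ε in H.
  ∣I∣≤1 : length I ≤ 1
  ∣I∣≤1 = Unique∧equal⇒length≤1 (Unique.filter⁺ selfInverseOutside? (Unique.allFin⁺ n)) λ a∈ b∈ →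
    equal (∈I⁻ a∈) (∈I⁻ b∈)
    where
    ∈I⁻ : ∀ {x} → x ∈ I → SelfInverseOutside x
    ∈I⁻ x∈ = proj₂ (∈-filter⁻ selfInverseOutside? {xs = allFin n} x∈)
    selfInverse⇒square≡ε : ∀ {x} → x ⁻¹ ≡ x → x ∙ x ≡ ε
    selfInverse⇒square≡ε {x} x⁻¹≡x = subst (λ y → x ∙ y ≡ ε) x⁻¹≡x (inverseʳ x)
    equal : ∀ {a b} → SelfInverseOutside a → SelfInverseOutside b → a ≡ b
    equal {a} {b} (c≡ε , a∉H , a⁻¹≡a) (_ , b∉H , b⁻¹≡b) = sym (trans (inverseʳ-unique a b ab≡ε) a⁻¹≡a)
      where
      ab∙ab≡ε : (a ∙ b) ∙ (a ∙ b) ≡ ε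
      ab∙ab≡ε = begin
        (a ∙ b) ∙ (a ∙ b)  ≡⟨ interchange a b a b ⟩
        (a ∙ a) ∙ (b ∙ b)  ≡⟨ cong₂ _∙_ (selfInverse⇒square≡ε a⁻¹≡a) (selfInverse⇒square≡ε b⁻¹≡b) ⟩
        ε ∙ ε              ≡⟨ identityˡ ε ⟩
        ε                  ∎
        where open ≡-Reasoning
      ab≡ε : a ∙ b ≡ ε
      ab≡ε = c-nontrivial c≡ε (∉∙∉⇒∈ a∉H b∉H) ab∙ab≡ε

  outH⊆I++V : outH ⊆ I ++ V
  outH⊆I++V {x} x∈ = place (proj₂ (∈-filter⁻ (∁? (_∈? H)) {xs = allFin n} x∈)) (c Fin.≟ ε) (x ⁻¹ Fin.≟ x)
    where
    place : x ∉ₛ H → Dec (c ≡ ε) → Dec (x ⁻¹ ≡ x) → x ∈ I ++ V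
    place x∉H (no c≢ε)  _             = ∈-++⁺ʳ I (∈V⁺ (x∉H , inj₁ c≢ε))
    place x∉H (yes _)   (no x⁻¹≢x)    = ∈-++⁺ʳ I (∈V⁺ (x∉H , inj₂ x⁻¹≢x))
    place x∉H (yes c≡ε) (yes x⁻¹≡x)   = ∈-++⁺ˡ (∈-filter⁺ selfInverseOutside? (∈-allFin x) (c≡ε , x∉H , x⁻¹≡x))

  n∸2≤∣V∣+∣V∣ : n ∸ 2 ≤ length V + length V
  n∸2≤∣V∣+∣V∣ = ∸-monoˡ-≤ 2 (begin
    n                                     ≡⟨ length-tabulate (λ x → x) ⟨
    length (allFin n)                     ≡⟨ length-filter+filter-∁ (_∈? H) (allFin n) ⟨
    length inH + length outH              ≤⟨ +-monoˡ-≤ (length outH) ∣inH∣≤∣outH∣ ⟩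
    length outH + length outH             ≤⟨ +-mono-≤ ∣outH∣≤1+∣V∣ ∣outH∣≤1+∣V∣ ⟩
    suc (length V) + suc (length V)       ≡⟨ cong suc (+-suc (length V) (length V)) ⟩
    2 + (length V + length V)             ∎)
    where
    open ≤-Reasoning
    ∣outH∣≤1+∣V∣ : length outH ≤ suc (length V)
    ∣outH∣≤1+∣V∣ = begin
      length outH          ≤⟨ Unique⇒length-mono-⊆ Fin._≟_ (Unique.filter⁺ _ (Unique.allFin⁺ n)) outH⊆I++V ⟩
      length (I ++ V)      ≡⟨ length-++ I ⟩
      length I + length V  ≤⟨ +-monoˡ-≤ (length V) ∣I∣≤1 ⟩
      suc (length V)       ∎

  2^[n∸2]≤fStarMax^4 : 2 ^ (n ∸ 2) ≤ fStarMax _∙_ ^ 4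
  2^[n∸2]≤fStarMax^4 = begin
    2 ^ (n ∸ 2)                         ≤⟨ ^-monoʳ-≤ 2 n∸2≤∣V∣+∣V∣ ⟩
    2 ^ (length V + length V)           ≡⟨ ^-distribˡ-+-* 2 (length V) (length V) ⟩
    2 ^ length V * 2 ^ length V         ≤⟨ *-mono-≤ many many ⟩
    (∣F∣ * ∣F∣) * (∣F∣ * ∣F∣)           ≡⟨ square-square≡^4 ∣F∣ ⟩
    ∣F∣ ^ 4                             ≤⟨ ^-monoˡ-≤ 4 ∣F∣≤fStarMax ⟩
    fStarMax _∙_ ^ 4                    ∎
    where
    open ≤-Reasoning
    open CrossingFamily (crossingFamily (length V) V ≤-refl V! V-classSizes)
    ∣F∣ = length members
    square-square≡^4 : ∀ m → (m * m) * (m * m) ≡ m ^ 4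
    square-square≡^4 m = trans (*-assoc m m (m * m)) (cong (λ k → m * (m * (m * k))) (sym (*-identityʳ m)))
    ∣F∣≤fStarMax : ∣F∣ ≤ fStarMax _∙_
    ∣F∣≤fStarMax = begin
      length members         ≡⟨ length-map S members ⟨
      length (map S members) ≤⟨ length≤fStarMax (map S members) (All.map⁺ members-free)
                                                    (AllPairs.map⁺ members-incompatible) ⟩
      fStarMax _∙_           ∎
      where
      members-free : All (DistinctSumFree _∙_ ∘ S) members
      members-free = All.tabulate λ T∈ → S-distinctSumFree (All.lookup ⊆V T∈) (All.lookup independent T∈)
      members-incompatible : AllPairs (Incompatible on S) members
      members-incompatible = AllPairs-zipWith-All crossing⇒incompatible ⊆V crossing

proposition5p3 : (n : ℕ) (_∙_ : Fin n → Fin n → Fin n) (ε : Fin n) (_⁻¹ : Fin n → Fin n) →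
    IsAbelianGroup _≡_ _∙_ ε _⁻¹ → 2 ∣ n →
    2 ^ (n ∸ 2) ≤ fStarMax _∙_ ^ 4
proposition5p3 n _∙_ ε _⁻¹ isAbelianGroup 2∣n =
  let H , H-indexTwo@(H-subgroup , _) = ∃-indexTwo 2∣n
      c , c∈H , c∙c≡ε , c-nontrivial  = ∃-involutionIn H (ProperSubgroup⊇Squares.ε∈ H-subgroup)
  in SumFreeConstruction.2^[n∸2]≤fStarMax^4 isAbelianGroup H-indexTwo c∈H c∙c≡ε c-nontrivial
  where open FiniteAbelianGroup isAbelianGroup
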